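{- Let $G$ be a finite simple triangle-free graph with minimum degree $\delta \ge 3$. Then $\delta + 1 \le Z(G)$.
   Context: Zero forcing process on a graph $G=(V,E)$: start with an initial set $S\subseteq V$ of colored vertices. A colored vertex $v$ forces an uncolored neighbor $w$ (making $w$ colored) if $w$ is the only uncolored neighbor of $v$; forces are applied repeatedly. $S$ is a zero forcing set if eventually every vertex becomes colored. The zero forcing number $Z(G)$ is the minimum size of a zero forcing set. Triangle-free means $G$ contains no cycle of length 3. -}

module Defs where

open import Data.Nat using (ℕ; _≤_)
open import Data.Bool using (Bool; true; false)
open import Data.Fin using (Fin)
open import Data.Fin.Subset using (Subset; _∈_; ∣_∣)
open import Data.List using (List; filter; length)
open import Data.List.Base using (allFin)
open import Data.Bool.Properties using (T?)
open import Data.Bool using (T)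
open import Data.Product using (Σ; _×_; ∃)
open import Data.Empty using (⊥)
open import Relation.Binary.PropositionalEquality using (_≡_; _≢_)

record Graph (n : ℕ) : Set where
  field
    adj   : Fin n → Fin n → Bool
    sym   : ∀ u v → adj u v ≡ adj v u
    irrefl : ∀ v → adj v v ≡ false

module _ {n : ℕ} (G : Graph n) where
  open Graph G

  Adj : Fin n → Fin n → Set
  Adj u v = adj u v ≡ true

  degree : Fin n → ℕ
  degree v = length (filter (λ u → T? (adj v u)) (allFin n))

  IsMinDegree : ℕ → Set
  IsMinDegree δ = (∀ v → δ ≤ degree v) × ∃ (λ v → degree v ≡ δ)

  TriangleFree : Set
  TriangleFree = ∀ a b c → Adj a b → Adj b c → Adj a c → ⊥

  -- Vertices coloured at the end of the zero forcing process started from S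
  -- (least set containing S and closed under the colour-change rule: a
  -- coloured v all of whose neighbours other than w are coloured forces its
  -- neighbour w).
  data Colored (S : Subset n) : Fin n → Set where
    initial : ∀ {v} → v ∈ S → Colored S v
    force   : ∀ {v w} → Colored S v → Adj v w
            → (∀ u → Adj v u → u ≢ w → Colored S u)
            → Colored S w

  IsZeroForcingSet : Subset n → Set
  IsZeroForcingSet S = ∀ v → Colored S v

  IsZeroForcingNumber : ℕ → Set
  IsZeroForcingNumber z =
    (Σ (Subset n) λ S → IsZeroForcingSet S × ∣ S ∣ ≡ z)
    × (∀ S → IsZeroForcingSet S → z ≤ ∣ S ∣)

module Submission where

-- Write N v for the neighbourhood of v and N[ v ] = N v ∪ {v}.  A vertex set
-- T is *closed* if the colour-change rule never leads out of it; by induction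
-- on the forcing derivation, everything coloured from S ⊆ T lies in T.  Take a
-- zero forcing set S.
--   * If S is itself closed, every vertex lies in S, so N v ⊂ S for any v.
--   * Otherwise some v ∈ S forces a vertex w ∉ S, so N[ v ] - w ⊆ S.  If
--     ∣ S ∣ ≤ ∣ N v ∣, counting shows S ⊆ N[ v ].  But in a triangle-free
--     graph with all degrees ≥ 3 every closed neighbourhood N[ v ] is closed,
--     and it misses a neighbour of w, so such an S cannot force everything.
-- Either way some vertex has degree < ∣ S ∣, whence δ < ∣ S ∣.

open import Defs
open import Data.Nat using (ℕ; zero; suc; _≤_; _<_; _+_; z≤n; s≤s)
open import Data.Nat.Properties
  using (≤-trans; ≤-reflexive; +-suc; +-comm; +-monoʳ-≤; +-monoˡ-≤; n≤1+n; module ≤-Reasoning; <-irrefl; ≰⇒>)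
open import Data.Bool using (Bool; true; false)
open import Data.Bool.Properties using (T?) renaming (_≟_ to _≟ᵇ_)
open import Data.Fin using (Fin; zero; suc)
open import Data.Fin.Properties using (_≟_; any?; all?; ¬∀⟶∃¬)
open import Data.Fin.Subset using (Subset; _∈_; _∉_; _⊆_; ⁅_⁆; _∪_; ∣_∣; inside; outside)
open import Data.Fin.Subset.Properties
  using (_∈?_; p⊆q⇒∣p∣≤∣q∣; p⊂q⇒∣p∣<∣q∣; x∈⁅x⁆; x∈⁅y⁆⇒x≡y; ∣⁅x⁆∣≡1; p⊆p∪q; q⊆p∪q; x∈p∪q⁻)
open import Data.List using (filter; length)
import Data.List.Base as List
open import Data.Vec using ([]; _∷_; tabulate)
open import Data.Vec.Properties using ([]=⇒lookup; lookup⇒[]=; lookup∘tabulate)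
open import Data.Product using (∃; ∃₂; _×_; _,_)
open import Data.Sum using (_⊎_; inj₁; inj₂)
open import Data.Empty using (⊥-elim)
open import Function using (_∘_; id)
open import Relation.Nullary using (¬_; Dec; yes; no)
open import Relation.Nullary.Decidable using (_×-dec_; _→-dec_; ¬?; decidable-stable)
open import Relation.Binary.PropositionalEquality using (_≡_; _≢_; refl; sym; trans; cong; cong₂; subst)

∣p∪q∣≤∣p∣+∣q∣ : ∀ {n} (p q : Subset n) → ∣ p ∪ q ∣ ≤ ∣ p ∣ + ∣ q ∣
∣p∪q∣≤∣p∣+∣q∣ []            []            = z≤n
∣p∪q∣≤∣p∣+∣q∣ (outside ∷ p) (outside ∷ q) = ∣p∪q∣≤∣p∣+∣q∣ p q
∣p∪q∣≤∣p∣+∣q∣ (inside  ∷ p) (outside ∷ q) = s≤s (∣p∪q∣≤∣p∣+∣q∣ p q)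
∣p∪q∣≤∣p∣+∣q∣ (outside ∷ p) (inside  ∷ q) =
  ≤-trans (s≤s (∣p∪q∣≤∣p∣+∣q∣ p q)) (≤-reflexive (sym (+-suc ∣ p ∣ ∣ q ∣)))
∣p∪q∣≤∣p∣+∣q∣ (inside  ∷ p) (inside  ∷ q) =
  s≤s (≤-trans (∣p∪q∣≤∣p∣+∣q∣ p q) (+-monoʳ-≤ ∣ p ∣ (n≤1+n ∣ q ∣)))

∣p∣<∣p∪⁅x⁆∣ : ∀ {n} (p : Subset n) {x} → x ∉ p → ∣ p ∣ < ∣ p ∪ ⁅ x ⁆ ∣
∣p∣<∣p∪⁅x⁆∣ p {x} x∉p = p⊂q⇒∣p∣<∣q∣ (p⊆p∪q ⁅ x ⁆ , x , q⊆p∪q p ⁅ x ⁆ (x∈⁅x⁆ x) , x∉p)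

⊆-or-escapes : ∀ {n} (p q : Subset n) → p ⊆ q ⊎ ∃ λ u → u ∈ p × u ∉ q
⊆-or-escapes {n} p q with all? (λ u → u ∈? p →-dec u ∈? q)
... | yes p⊆q = inj₁ (λ {u} → p⊆q u)
... | no  p⊈q with ¬∀⟶∃¬ n _ (λ u → u ∈? p →-dec u ∈? q) p⊈q
...   | u , ¬[u∈p→u∈q] =
  inj₂ (u , decidable-stable (u ∈? p) (λ u∉p → ¬[u∈p→u∈q] (⊥-elim ∘ u∉p))
          , λ u∈q → ¬[u∈p→u∈q] (λ _ → u∈q))

avoid-two : ∀ {n} (p : Subset n) x y → 3 ≤ ∣ p ∣ → ∃ λ u → u ∈ p × u ≢ x × u ≢ y
avoid-two p x y 3≤∣p∣ with ⊆-or-escapes p (⁅ x ⁆ ∪ ⁅ y ⁆)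
... | inj₂ (u , u∈p , u∉xy) =
  u , u∈p , (λ { refl → u∉xy (p⊆p∪q ⁅ y ⁆ (x∈⁅x⁆ x)) })
          , (λ { refl → u∉xy (q⊆p∪q ⁅ x ⁆ ⁅ y ⁆ (x∈⁅x⁆ y)) })
... | inj₁ p⊆xy = ⊥-elim (<-irrefl refl (≤-trans 3≤∣p∣ ∣p∣≤2))
  where
  ∣p∣≤2 : ∣ p ∣ ≤ 2
  ∣p∣≤2 = ≤-trans (p⊆q⇒∣p∣≤∣q∣ p⊆xy)
         (subst (∣ ⁅ x ⁆ ∪ ⁅ y ⁆ ∣ ≤_) (cong₂ _+_ (∣⁅x⁆∣≡1 x) (∣⁅x⁆∣≡1 y)) (∣p∪q∣≤∣p∣+∣q∣ ⁅ x ⁆ ⁅ y ⁆))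

module _ {n : ℕ} (G : Graph n) where
  open Graph G using (adj; irrefl)

  N : Fin n → Subset n
  N v = tabulate (adj v)

  ∈N⇒Adj : ∀ {v u} → u ∈ N v → Adj G v u
  ∈N⇒Adj {v} {u} u∈N = trans (sym (lookup∘tabulate (adj v) u)) ([]=⇒lookup u∈N)

  Adj⇒∈N : ∀ {v u} → Adj G v u → u ∈ N v
  Adj⇒∈N {v} {u} a = lookup⇒[]= u (N v) (trans (lookup∘tabulate (adj v) u) a)

  ∉N-self : ∀ v → v ∉ N v
  ∉N-self v v∈N with trans (sym (irrefl v)) (∈N⇒Adj v∈N)
  ... | ()

  N[_] : Fin n → Subset n
  N[ v ] = N v ∪ ⁅ v ⁆

  ∈N[]⁻ : ∀ {v u} → u ∈ N[ v ] → Adj G v u ⊎ u ≡ v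
  ∈N[]⁻ {v} u∈N[v] with x∈p∪q⁻ (N v) ⁅ v ⁆ u∈N[v]
  ... | inj₁ u∈Nv   = inj₁ (∈N⇒Adj u∈Nv)
  ... | inj₂ u∈⁅v⁆ = inj₂ (x∈⁅y⁆⇒x≡y v u∈⁅v⁆)

  degree≡∣N∣ : ∀ v → degree G v ≡ ∣ N v ∣
  degree≡∣N∣ v = count-filter (adj v) id
    where
    count-filter : ∀ {m} (f : Fin n → Bool) (g : Fin m → Fin n)
                 → length (filter (T? ∘ f) (List.tabulate g)) ≡ ∣ tabulate (f ∘ g) ∣
    count-filter {zero}  f g = refl
    count-filter {suc m} f g with f (g zero)
    ... | true  = cong suc (count-filter f (g ∘ suc))
    ... | false = count-filter f (g ∘ suc)

  Closed : Subset n → Set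
  Closed T = ∀ {v w} → v ∈ T → Adj G v w → (∀ u → Adj G v u → u ≢ w → u ∈ T) → w ∈ T

  colored⊆closed : ∀ {S T} → S ⊆ T → Closed T → ∀ {y} → Colored G S y → y ∈ T
  colored⊆closed S⊆T closed (initial y∈S)          = S⊆T y∈S
  colored⊆closed S⊆T closed (force colv vw others) =
    closed (colored⊆closed S⊆T closed colv) vw
           (λ u vu u≢w → colored⊆closed S⊆T closed (others u vu u≢w))

  LeavingForce : Subset n → Fin n → Fin n → Set
  LeavingForce S v w = v ∈ S × Adj G v w × w ∉ S × (∀ u → Adj G v u → u ≢ w → u ∈ S)

  leaving? : ∀ S v w → Dec (LeavingForce S v w)
  leaving? S v w = v ∈? S ×-dec adj v w ≟ᵇ true ×-dec ¬? (w ∈? S)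
                   ×-dec all? (λ u → adj v u ≟ᵇ true →-dec ¬? (u ≟ w) →-dec u ∈? S)

  closed-or-leaving : ∀ S → Closed S ⊎ ∃₂ (LeavingForce S)
  closed-or-leaving S with any? (λ v → any? (λ w → leaving? S v w))
  ... | yes (v , w , leaving) = inj₂ (v , w , leaving)
  ... | no  ¬leaving          = inj₁ λ {v} {w} v∈S vw others →
    decidable-stable (w ∈? S) (λ w∉S → ¬leaving (v , w , v∈S , vw , w∉S , others))

  -- If S is closed it already contains every vertex, so it is larger than
  -- any neighbourhood (which misses its own centre).
  closed-zfs-large : ∀ {S} → Closed S → IsZeroForcingSet G S → ∀ v → ∣ N v ∣ < ∣ S ∣
  closed-zfs-large {S} closed zfs v = p⊂q⇒∣p∣<∣q∣ ((λ {u} _ → all∈S u) , v , all∈S v , ∉N-self v)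
    where
    all∈S : ∀ u → u ∈ S
    all∈S u = colored⊆closed id closed (zfs u)

  -- If v ∈ S forces w ∉ S then N[ v ] ⊆ S ∪ {w}.  A vertex y ∈ S outside
  -- N[ v ] would give deg v + 2 ≤ ∣ N[ v ] ∪ {y} ∣ ≤ ∣ S ∣ + 1, so when
  -- ∣ S ∣ ≤ deg v the set S lies inside N[ v ].
  leaving-force-traps : ∀ {S v w} → LeavingForce S v w → ∣ S ∣ ≤ ∣ N v ∣ → S ⊆ N[ v ]
  leaving-force-traps {S} {v} {w} (v∈S , _ , _ , others) small {y} y∈S with y ∈? N[ v ]
  ... | yes y∈N[v] = y∈N[v]
  ... | no  y∉N[v] = ⊥-elim (<-irrefl refl (begin-strict
    suc ∣ N v ∣            ≤⟨ ∣p∣<∣p∪⁅x⁆∣ (N v) (∉N-self v) ⟩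
    ∣ N[ v ] ∣             <⟨ ∣p∣<∣p∪⁅x⁆∣ N[ v ] y∉N[v] ⟩
    ∣ N[ v ] ∪ ⁅ y ⁆ ∣     ≤⟨ p⊆q⇒∣p∣≤∣q∣ N[v]∪y⊆S∪w ⟩
    ∣ S ∪ ⁅ w ⁆ ∣          ≤⟨ ∣p∪q∣≤∣p∣+∣q∣ S ⁅ w ⁆ ⟩
    ∣ S ∣ + ∣ ⁅ w ⁆ ∣      ≡⟨ cong (∣ S ∣ +_) (∣⁅x⁆∣≡1 w) ⟩
    ∣ S ∣ + 1              ≤⟨ +-monoˡ-≤ 1 small ⟩
    ∣ N v ∣ + 1            ≡⟨ +-comm ∣ N v ∣ 1 ⟩
    suc ∣ N v ∣            ∎))
    where
    open ≤-Reasoning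
    N[v]∪y⊆S∪w : N[ v ] ∪ ⁅ y ⁆ ⊆ S ∪ ⁅ w ⁆
    N[v]∪y⊆S∪w {u} u∈ with x∈p∪q⁻ N[ v ] ⁅ y ⁆ u∈
    ... | inj₂ u∈⁅y⁆ rewrite x∈⁅y⁆⇒x≡y y u∈⁅y⁆ = p⊆p∪q ⁅ w ⁆ y∈S
    ... | inj₁ u∈N[v] with ∈N[]⁻ u∈N[v]
    ...   | inj₂ refl = p⊆p∪q ⁅ w ⁆ v∈S
    ...   | inj₁ vu with u ≟ w
    ...     | yes refl = q⊆p∪q S ⁅ w ⁆ (x∈⁅x⁆ w)
    ...     | no  u≢w  = p⊆p∪q ⁅ w ⁆ (others u vu u≢w)

  module _ (triangle-free : TriangleFree G) (deg≥3 : ∀ a → 3 ≤ ∣ N a ∣) where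

    -- A neighbour a of v cannot force: it has a neighbour u ∉ {v, b}, which
    -- lies in N[ v ] and would close a triangle v a u.  So only v itself
    -- forces from N[ v ], and only into N v.
    closedNbhd-closed : ∀ v → Closed N[ v ]
    closedNbhd-closed v {a} {b} a∈N[v] ab others with ∈N[]⁻ a∈N[v]
    ... | inj₂ refl = p⊆p∪q ⁅ v ⁆ (Adj⇒∈N ab)
    ... | inj₁ va with avoid-two (N a) v b (deg≥3 a)
    ...   | u , u∈Na , u≢v , u≢b with ∈N[]⁻ (others u (∈N⇒Adj u∈Na) u≢b)
    ...     | inj₁ vu = ⊥-elim (triangle-free v a u va (∈N⇒Adj u∈Na) vu)
    ...     | inj₂ u≡v = ⊥-elim (u≢v u≡v)

    -- A neighbour w of v has a neighbour u ≠ v, and u ∉ N v by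
    -- triangle-freeness: closed neighbourhoods are proper.
    closedNbhd-proper : ∀ v → ∃ λ u → u ∉ N[ v ]
    closedNbhd-proper v with avoid-two (N v) v v (deg≥3 v)
    ... | w , w∈Nv , _ with avoid-two (N w) v v (deg≥3 w)
    ...   | u , u∈Nw , u≢v , _ = u , u∉N[v]
      where
      u∉N[v] : u ∉ N[ v ]
      u∉N[v] u∈N[v] with ∈N[]⁻ u∈N[v]
      ... | inj₁ vu  = triangle-free v w u (∈N⇒Adj w∈Nv) (∈N⇒Adj u∈Nw) vu
      ... | inj₂ u≡v = u≢v u≡v

    zfs-not-in-closedNbhd : ∀ {S v} → IsZeroForcingSet G S → ¬ (S ⊆ N[ v ])
    zfs-not-in-closedNbhd {v = v} zfs S⊆N[v] with closedNbhd-proper v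
    ... | u , u∉N[v] = u∉N[v] (colored⊆closed S⊆N[v] (closedNbhd-closed v) (zfs u))

    -- Every zero forcing set is larger than the degree of some vertex (the
    -- vertex v₀ only witnesses that the graph is nonempty).
    zfs-large : ∀ {S} → Fin n → IsZeroForcingSet G S → ∃ λ v → ∣ N v ∣ < ∣ S ∣
    zfs-large {S} v₀ zfs with closed-or-leaving S
    ... | inj₁ closed            = v₀ , closed-zfs-large closed zfs v₀
    ... | inj₂ (v , w , leaving) =
      v , ≰⇒> (λ small → zfs-not-in-closedNbhd zfs (leaving-force-traps leaving small))

δ≤∣N∣ : ∀ {n} (G : Graph n) {δ} → (∀ v → δ ≤ degree G v) → ∀ v → δ ≤ ∣ N G v ∣
δ≤∣N∣ G {δ} δ≤degree v = subst (δ ≤_) (degree≡∣N∣ G v) (δ≤degree v)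

theorem1 : ∀ (n : ℕ) (G : Graph n) (δ z : ℕ)
         → TriangleFree G → IsMinDegree G δ → 3 ≤ δ
         → IsZeroForcingNumber G z → δ + 1 ≤ z
theorem1 n G δ z triangle-free (δ≤degree , v₀ , _) 3≤δ ((S , zfs , ∣S∣≡z) , _)
  with zfs-large G triangle-free (λ a → ≤-trans 3≤δ (δ≤∣N∣ G δ≤degree a)) v₀ zfs
... | v , ∣Nv∣<∣S∣ = begin
  δ + 1          ≡⟨ +-comm δ 1 ⟩
  suc δ          ≤⟨ s≤s (δ≤∣N∣ G δ≤degree v) ⟩
  suc ∣ N G v ∣  ≤⟨ ∣Nv∣<∣S∣ ⟩
  ∣ S ∣          ≡⟨ ∣S∣≡z ⟩
  z              ∎
  where open ≤-Reasoning
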